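{- Let $P$ be a permutation matrix and let $X=(x_1,x_2,\dots,x_m)$ be a spanning oscillation of $P$ of minimum length $m$ (among all spanning oscillations of $P$). Then $P$ has a tall spanning oscillation of length $m$ that starts with $x_1,x_2$ and ends with $x_{m-1},x_m$.
   Context: A permutation matrix is a square 0-1 matrix with exactly one 1 in each row and column. 1-entries are identified with positions $(i,j)$ ($i$ = row from the top, $j$ = column from the left); $(i,j)$ is above $(i',j')$ if $i<i'$, below if $i>i'$, to the left if $j<j'$, to the right if $j>j'$. $\ell_P,r_P,t_P,b_P$ denote the leftmost, rightmost, topmost and bottommost 1-entries of $P$. The permutation graph $G_P$ has the 1-entries of $P$ as vertices, with an edge between $x$ and $y$ iff one is below and to the left of the other. An oscillation is a sequence $(x_1,\dots,x_m)$ of distinct 1-entries forming an induced path in $G_P$; it is spanning if $\{x_1,x_2\}=\{\ell_P,t_P\}$ and $\{x_{m-1},x_m\}=\{b_P,r_P\}$. In a spanning oscillation, for $2\le i\le m-1$, $x_i$ is called upper if it is above and to the right of both $x_{i-1}$ and $x_{i+1}$. A spanning oscillation $(x_1,\dots,x_m)$ is tall if for every $2\le i\le m-2$ such that $x_i$ is upper: (i) $P$ has no 1-entry that is below $x_{i+1}$ and to the left of $x_i$, and (ii) $P$ has no 1-entry that is above $x_i$ and to the right of $x_{i+1}$. -}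

module Defs where

open import Data.Nat as ℕ using (ℕ; zero; suc; _∸_)
open import Data.Fin as Fin using (Fin)
open import Data.Fin.Permutation using (Permutation′; _⟨$⟩ʳ_)
open import Data.Vec using (Vec; lookup)
open import Data.Product using (_×_; Σ; ∃)
open import Data.Sum using (_⊎_)
open import Relation.Nullary using (¬_)
open import Relation.Binary.PropositionalEquality using (_≡_)

-- An n×n permutation matrix P is given by a permutation of Fin n:
-- its 1-entries are the positions (i , P ⟨$⟩ʳ i) for i : Fin n.
-- A 1-entry is identified with its row index i : Fin n (rows 0-based, from
-- the top; columns 0-based, from the left).

PermMatrix : ℕ → Set
PermMatrix n = Permutation′ n

module _ {n : ℕ} (P : PermMatrix n) where

  Entry : Set
  Entry = Fin n

  row : Entry → Fin n
  row x = x

  col : Entry → Fin n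
  col x = P ⟨$⟩ʳ x

  Above Below LeftOf RightOf : Entry → Entry → Set
  Above   x y = row x Fin.< row y
  Below   x y = row y Fin.< row x
  LeftOf  x y = col x Fin.< col y
  RightOf x y = col y Fin.< col x

  IsLeftmost IsRightmost IsTopmost IsBottommost : Entry → Set
  IsLeftmost   x = ∀ y → col x Fin.≤ col y
  IsRightmost  x = ∀ y → col y Fin.≤ col x
  IsTopmost    x = ∀ y → row x Fin.≤ row y
  IsBottommost x = ∀ y → row y Fin.≤ row x

  Adj : Entry → Entry → Set
  Adj x y = (Below x y × LeftOf x y) ⊎ (Below y x × LeftOf y x)

  at : ∀ {m} → Vec Entry m → (i : ℕ) → i ℕ.< m → Entry
  at xs i p = lookup xs (Fin.fromℕ< p)

  -- oscillation: distinct entries forming an induced path in G_P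
  -- (0-based indices: x_0 … x_{m-1})
  record IsOscillation {m : ℕ} (xs : Vec Entry m) : Set where
    field
      distinct : ∀ i j (p : i ℕ.< m) (q : j ℕ.< m) → at xs i p ≡ at xs j q → i ≡ j
      consec   : ∀ i (p : i ℕ.< m) (q : suc i ℕ.< m) → Adj (at xs i p) (at xs (suc i) q)
      induced  : ∀ i j (p : i ℕ.< m) (q : j ℕ.< m) → suc i ℕ.< j → ¬ Adj (at xs i p) (at xs j q)

  PairIs : Entry → Entry → (Entry → Set) → (Entry → Set) → Set
  PairIs a b U V = (U a × V b) ⊎ (V a × U b)

  record IsSpanningOscillation {m : ℕ} (xs : Vec Entry m) : Set where
    field
      osc   : IsOscillation xs
      len≥2 : 2 ℕ.≤ m
      start : (p : 0 ℕ.< m) (q : 1 ℕ.< m) → PairIs (at xs 0 p) (at xs 1 q) IsLeftmost IsTopmost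
      end   : (p : m ∸ 2 ℕ.< m) (q : m ∸ 1 ℕ.< m) →
              PairIs (at xs (m ∸ 2) p) (at xs (m ∸ 1) q) IsBottommost IsRightmost

  IsUpper : Entry → Entry → Entry → Set
  IsUpper prev x next = Above x prev × RightOf x prev × Above x next × RightOf x next

  -- tall: for every paper index 2 ≤ i ≤ m-2 (0-based 1 ≤ i ≤ m-3) with x_i upper,
  -- (i) no entry below x_{i+1} and left of x_i,
  -- (ii) no entry above x_i and right of x_{i+1}.
  IsTall : ∀ {m} → Vec Entry m → Set
  IsTall {m} xs =
    ∀ i (p : i ℕ.< m) (q : suc i ℕ.< m) (r : suc (suc i) ℕ.< m) → suc (suc (suc i)) ℕ.< m →
    IsUpper (at xs i p) (at xs (suc i) q) (at xs (suc (suc i)) r) →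
      (∀ z → ¬ (Below z (at xs (suc (suc i)) r) × LeftOf z (at xs (suc i) q)))
    × (∀ z → ¬ (Above z (at xs (suc i) q) × RightOf z (at xs (suc (suc i)) r)))

  IsTallSpanningOscillation : ∀ {m} → Vec Entry m → Set
  IsTallSpanningOscillation xs = IsSpanningOscillation xs × IsTall xs

  IsMinSpanningOscillation : ∀ {m} → Vec Entry m → Set
  IsMinSpanningOscillation {m} xs =
    IsSpanningOscillation xs × (∀ m' (ys : Vec Entry m') → IsSpanningOscillation ys → m ℕ.≤ m')

module Submission where

-- In a spanning oscillation x₀ … x_{m-1} every entry lies above and to the left of all entries at least
-- two steps later: the path starts at the top-left corner and, being induced, cannot turn back.
-- Suppose the oscillation is not tall at an upper entry x_i. An obstruction z of type (i) lies below x_{i+1}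
-- and left of x_i, hence outside the oscillation, and adjacent to x_i and x_{i+2}. If z were adjacent to any
-- other entry, the path through the first and the last entries adjacent to z would be a shorter spanning
-- oscillation; so, by minimality, replacing x_{i+1} by z yields again a spanning oscillation of length m.
-- Type (ii) is type (i) for the reversed oscillation of the point-reflected matrix, and there z replaces x_i.
-- Each replacement moves an entry away, in row order, from both its neighbours, so the vertical length
-- Σ |row x_k − row x_{k+1}| strictly increases. It is bounded by m n, so after finitely many replacements
-- the oscillation is tall; the first two and the last two entries are never replaced.

open import Level using (0ℓ)
open import Data.Nat using (ℕ; zero; suc; z<s; _+_; _*_; _∸_; pred; _<_; _≤_; z≤n; s≤s; _≟_; _<?_; ∣_-_∣)
open import Data.Nat.Properties
open import Data.Vec using (Vec; []; _∷_; tabulate)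
open import Data.Vec.Properties using (lookup∘tabulate)
open import Data.Fin as Fin using (Fin; toℕ)
import Data.Fin.Properties as Fin
open import Data.Fin.Properties using (toℕ-fromℕ<; toℕ<n; any?)
open import Data.Fin.Permutation using (_⟨$⟩ʳ_)
open import Function.Bundles using (Injection)
open import Function.Properties.Inverse using (↔⇒↣)
open import Data.Product as Product using (Σ; _×_; _,_; proj₁; proj₂)
open import Data.Sum as Sum using (_⊎_; inj₁; inj₂; [_,_]′)
open import Function using (flip; _∘_)
open import Relation.Nullary using (¬_; Dec; yes; no; contradiction)
open import Relation.Nullary.Decidable using (_×-dec_; _⊎-dec_)
open import Relation.Binary using (Rel; IsStrictTotalOrder; Tri; tri<; tri≈; tri>)
open import Relation.Binary.Structures.Biased using (isStrictTotalOrderᶜ)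
import Relation.Binary.Construct.Flip.EqAndOrd as Flip
open import Relation.Binary.PropositionalEquality using (_≡_; _≢_; refl; sym; trans; cong; cong₂; subst; subst₂; isEquivalence)

open import Defs using (PermMatrix; Entry; at; IsTallSpanningOscillation; IsMinSpanningOscillation)
import Defs

-- Finite sequences are modelled as functions ℕ → A together with a length;
-- values beyond the length are irrelevant.

module _ {A : Set} where

  pair : A → A → ℕ → A
  pair x y zero    = x
  pair x y (suc _) = y

  cons : A → (ℕ → A) → ℕ → A
  cons z s zero    = z
  cons z s (suc j) = s j

  splice : (ℕ → A) → ℕ → (ℕ → A) → ℕ → A
  splice p zero    s k       = s k
  splice p (suc α) s zero    = p zero
  splice p (suc α) s (suc k) = splice (λ i → p (suc i)) α s k

  splice-prefix : ∀ p s α k → k < α → splice p α s k ≡ p k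
  splice-prefix p s (suc α) zero    _       = refl
  splice-prefix p s (suc α) (suc k) (s≤s k<α) = splice-prefix (λ i → p (suc i)) s α k k<α

  splice-suffix : ∀ p s α j → splice p α s (α + j) ≡ s j
  splice-suffix p s zero    j = refl
  splice-suffix p s (suc α) j = splice-suffix (λ i → p (suc i)) s α j

  opaque
    _[_]≔_ : (ℕ → A) → ℕ → A → ℕ → A
    (g [ q ]≔ z) k with k ≟ q
    ... | yes _ = z
    ... | no  _ = g k

    []≔-updated : ∀ g q z → (g [ q ]≔ z) q ≡ z
    []≔-updated g q z with q ≟ q
    ... | yes _ = refl
    ... | no q≢q = contradiction refl q≢q

    []≔-unchanged : ∀ g q z {k} → k ≢ q → (g [ q ]≔ z) k ≡ g k
    []≔-unchanged g q z {k} k≢q with k ≟ q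
    ... | yes k≡q = contradiction k≡q k≢q
    ... | no  _   = refl

data SpliceView (α k : ℕ) : Set where
  prefix : k < α → SpliceView α k
  suffix : (j : ℕ) → k ≡ α + j → SpliceView α k

spliceView : ∀ α k → SpliceView α k
spliceView zero    k       = suffix k refl
spliceView (suc α) zero    = prefix (s≤s z≤n)
spliceView (suc α) (suc k) with spliceView α k
... | prefix k<α = prefix (s≤s k<α)
... | suffix j e = suffix j (cong suc e)

least-witness : {Q : ℕ → Set} → (∀ k → Dec (Q k)) → ∀ {n} → Q n →
  Σ ℕ λ a → a ≤ n × Q a × (∀ k → k < a → ¬ Q k)
least-witness Q? {n} qn with Q? 0
... | yes q₀ = 0 , z≤n , q₀ , λ _ ()
least-witness Q? {zero}  q₀ | no ¬q₀ = contradiction q₀ ¬q₀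
least-witness Q? {suc n} qn | no ¬q₀ with least-witness (Q? ∘ suc) {n} qn
... | a , a≤n , qa , below = suc a , s≤s a≤n , qa , λ { zero _ → ¬q₀ ; (suc k) (s≤s k<a) → below k k<a }

greatest-witness : {Q : ℕ → Set} → (∀ k → Dec (Q k)) → ∀ {n} M → n < M → Q n →
  Σ ℕ λ b → n ≤ b × b < M × Q b × (∀ k → b < k → k < M → ¬ Q k)
greatest-witness Q? (suc N) (s≤s n≤N) qn with Q? N
... | yes qN = N , n≤N , ≤-refl , qN , λ k N<k k<1+N → contradiction (≤-pred k<1+N) (<⇒≱ N<k)
... | no ¬qN with m≤n⇒m<n∨m≡n n≤N
...   | inj₂ refl = contradiction qn ¬qN
...   | inj₁ n<N with greatest-witness Q? N n<N qn
...     | b , n≤b , b<N , qb , above = b , n≤b , m<n⇒m<1+n b<N , qb ,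
          λ k b<k k<1+N → [ above k b<k , (λ { refl → ¬qN }) ]′ (m<1+n⇒m<n∨m≡n k<1+N)

-- x <r y : x lies in a higher row than y;  x <c y : x lies in a column to the left of y.
module Oscillations {A : Set} (_<r_ _<c_ : Rel A 0ℓ) where

  Adj : Rel A 0ℓ
  Adj x y = (y <r x × x <c y) ⊎ (x <r y × y <c x)

  _≺_ : Rel A 0ℓ
  x ≺ y = x <r y × x <c y

  Leftmost Rightmost Topmost Bottommost : A → Set
  Leftmost   x = ∀ y → ¬ y <c x
  Rightmost  x = ∀ y → ¬ x <c y
  Topmost    x = ∀ y → ¬ y <r x
  Bottommost x = ∀ y → ¬ x <r y

  PairIs : A → A → (A → Set) → (A → Set) → Set
  PairIs a b U V = (U a × V b) ⊎ (V a × U b)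

  record IsInducedPath (f : ℕ → A) (L : ℕ) : Set where
    field
      distinct    : ∀ i j → i < L → j < L → f i ≡ f j → i ≡ j
      consecutive : ∀ i → suc i < L → Adj (f i) (f (suc i))
      induced     : ∀ i j → j < L → suc i < j → ¬ Adj (f i) (f j)

  record IsSpanning (f : ℕ → A) (L : ℕ) : Set where
    field
      path     : IsInducedPath f L
      2≤length : 2 ≤ L
      start    : PairIs (f 0) (f 1) Leftmost Topmost
      end      : PairIs (f (L ∸ 2)) (f (L ∸ 1)) Bottommost Rightmost
    open IsInducedPath path public

  IsMinimalLength : ℕ → Set
  IsMinimalLength m = ∀ m′ f → IsSpanning f m′ → m ≤ m′

  IsUpper : A → A → A → Set
  IsUpper p x q = x <r p × p <c x × x <r q × q <c x

  Unobstructed : A → A → Set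
  Unobstructed x y = (∀ z → ¬ (y <r z × z <c x)) × (∀ z → ¬ (z <r x × y <c z))

  IsTall : (ℕ → A) → ℕ → Set
  IsTall f m = ∀ i → suc (suc (suc i)) < m →
    IsUpper (f i) (f (suc i)) (f (suc (suc i))) → Unobstructed (f (suc i)) (f (suc (suc i)))

  restrict : ∀ {f L L′} → L′ ≤ L → IsInducedPath f L → IsInducedPath f L′
  restrict L′≤L path = record
    { distinct    = λ i j i< j< → distinct i j (≤-trans i< L′≤L) (≤-trans j< L′≤L)
    ; consecutive = λ i i< → consecutive i (≤-trans i< L′≤L)
    ; induced     = λ i j j< → induced i j (≤-trans j< L′≤L) }
    where open IsInducedPath path

  shift : ∀ {f} b L → IsInducedPath f (b + L) → IsInducedPath (λ j → f (b + j)) L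
  shift {f} b L path = record
    { distinct    = λ i j i< j< e → +-cancelˡ-≡ b i j (distinct _ _ (+-monoʳ-< b i<) (+-monoʳ-< b j<) e)
    ; consecutive = λ i i< → subst (λ k → Adj (f (b + i)) (f k)) (sym (+-suc b i))
                               (consecutive (b + i) (subst (_< b + L) (+-suc b i) (+-monoʳ-< b i<)))
    ; induced     = λ i j j< i<j → induced (b + i) (b + j) (+-monoʳ-< b j<)
                                     (subst (_< b + j) (+-suc b i) (+-monoʳ-< b i<j)) }
    where open IsInducedPath path

  pair-path : ∀ {x y} → Adj x y → x ≢ y → IsInducedPath (pair x y) 2
  pair-path {x} {y} x~y x≢y = record
    { distinct    = distinct
    ; consecutive = λ { zero _ → x~y ; (suc i) (s≤s (s≤s ())) }
    ; induced     = λ { i (suc (suc j)) (s≤s (s≤s ())) _ ; zero (suc zero) _ (s≤s ())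
                      ; (suc i) (suc zero) _ (s≤s ()) ; _ zero _ () } }
    where
    distinct : ∀ i j → i < 2 → j < 2 → pair x y i ≡ pair x y j → i ≡ j
    distinct zero          zero          _ _ _ = refl
    distinct zero          (suc zero)    _ _ e = contradiction e x≢y
    distinct (suc zero)    zero          _ _ e = contradiction (sym e) x≢y
    distinct (suc zero)    (suc zero)    _ _ _ = refl
    distinct (suc (suc i)) _ (s≤s (s≤s ())) _ _
    distinct _ (suc (suc j)) _ (s≤s (s≤s ())) _

  cons-path : ∀ {z s β} → IsInducedPath s β → Adj z (s 0) →
    (∀ j → 1 ≤ j → j < β → ¬ Adj z (s j)) → (∀ j → j < β → z ≢ s j) →
    IsInducedPath (cons z s) (suc β)
  cons-path {z} {s} {β} path z~s₀ z≁s z≢s = record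
    { distinct    = distinct′
    ; consecutive = λ { zero _ → z~s₀ ; (suc i) (s≤s i<) → consecutive i i< }
    ; induced     = λ { zero (suc j) (s≤s j<) (s≤s 1≤j) → z≁s j 1≤j j<
                      ; (suc i) (suc j) (s≤s j<) (s≤s i<j) → induced i j j< i<j } }
    where
    open IsInducedPath path
    distinct′ : ∀ i j → i < suc β → j < suc β → cons z s i ≡ cons z s j → i ≡ j
    distinct′ zero    zero    _       _       _ = refl
    distinct′ zero    (suc j) _       (s≤s j<) e = contradiction e (z≢s j j<)
    distinct′ (suc i) zero    (s≤s i<) _       e = contradiction (sym e) (z≢s i i<)
    distinct′ (suc i) (suc j) (s≤s i<) (s≤s j<) e = cong suc (distinct i j i< j< e)

  splice-path : ∀ {p α s β} → IsInducedPath p (suc α) → IsInducedPath s β → Adj (p α) (s 0) →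
    (∀ i j → i < suc α → j < β → suc i < suc α + j → ¬ Adj (p i) (s j)) →
    (∀ i j → i < suc α → j < β → p i ≢ s j) →
    IsInducedPath (splice p (suc α) s) (suc α + β)
  splice-path {p} {α} {s} {β} pathₚ pathₛ bridge p≁s p≢s =
    record { distinct = distinct ; consecutive = consecutive ; induced = induced }
    where
    module P = IsInducedPath pathₚ
    module S = IsInducedPath pathₛ
    G = splice p (suc α) s
    pre : ∀ {k} → k < suc α → G k ≡ p k
    pre = splice-prefix p s (suc α) _
    suf : ∀ j → G (suc α + j) ≡ s j
    suf = splice-suffix p s (suc α)
    cancel : ∀ {j} → suc α + j < suc α + β → j < β
    cancel = +-cancelˡ-< (suc α) _ _
    distinct : ∀ i j → i < suc α + β → j < suc α + β → G i ≡ G j → i ≡ j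
    distinct i j i< j< e with spliceView (suc α) i | spliceView (suc α) j
    ... | prefix a | prefix b = P.distinct i j a b (trans (sym (pre a)) (trans e (pre b)))
    ... | prefix a | suffix j′ refl =
          contradiction (trans (sym (pre a)) (trans e (suf j′))) (p≢s i j′ a (cancel j<))
    ... | suffix i′ refl | prefix b =
          contradiction (trans (sym (pre b)) (trans (sym e) (suf i′))) (p≢s j i′ b (cancel i<))
    ... | suffix i′ refl | suffix j′ refl =
          cong (suc α +_) (S.distinct i′ j′ (cancel i<) (cancel j<) (trans (sym (suf i′)) (trans e (suf j′))))
    consecutive : ∀ i → suc i < suc α + β → Adj (G i) (G (suc i))
    consecutive i i< with spliceView (suc α) (suc i)
    ... | prefix a = subst₂ Adj (sym (pre (<⇒≤ a))) (sym (pre a)) (P.consecutive i a)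
    ... | suffix zero e =
          subst₂ Adj (sym (trans (cong G i≡α) (pre ≤-refl))) (sym (trans (cong G e) (suf 0))) bridge
      where i≡α = suc-injective (trans e (+-identityʳ (suc α)))
    ... | suffix (suc j) e =
          subst₂ Adj (sym (trans (cong G i≡) (suf j))) (sym (trans (cong G e) (suf (suc j))))
            (S.consecutive j (cancel (subst (_< suc α + β) e i<)))
      where i≡ = suc-injective (trans e (+-suc (suc α) j))
    induced : ∀ i j → j < suc α + β → suc i < j → ¬ Adj (G i) (G j)
    induced i j j< i<j with spliceView (suc α) i | spliceView (suc α) j
    ... | prefix a | prefix b =
          subst₂ (λ x y → ¬ Adj x y) (sym (pre a)) (sym (pre b)) (P.induced i j b i<j)
    ... | prefix a | suffix j′ refl =
          subst₂ (λ x y → ¬ Adj x y) (sym (pre a)) (sym (suf j′)) (p≁s i j′ a (cancel j<) i<j)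
    ... | suffix i′ refl | prefix b =
          contradiction (≤-trans (m≤m+n (suc α) i′) (<⇒≤ (<⇒≤ i<j))) (<⇒≱ b)
    ... | suffix i′ refl | suffix j′ refl =
          subst₂ (λ x y → ¬ Adj x y) (sym (suf i′)) (sym (suf j′))
            (S.induced i′ j′ (cancel j<)
              (+-cancelˡ-< (suc α) _ _ (subst (_< suc α + j′) (sym (+-suc (suc α) i′)) i<j)))

  record Head (z : A) : Set where
    field
      seq      : ℕ → A
      last     : ℕ
      path     : IsInducedPath seq (suc (suc last))
      start    : PairIs (seq 0) (seq 1) Leftmost Topmost
      attached : Adj (seq (suc last)) z
      detached : ∀ i → i < suc last → ¬ Adj (seq i) z
      avoids   : ∀ i → i < suc (suc last) → seq i ≢ z

  record Tail (z : A) : Set where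
    field
      seq      : ℕ → A
      last     : ℕ
      path     : IsInducedPath seq (suc (suc last))
      end      : PairIs (seq last) (seq (suc last)) Bottommost Rightmost
      attached : Adj z (seq 0)
      detached : ∀ j → 1 ≤ j → j < suc (suc last) → ¬ Adj z (seq j)
      avoids   : ∀ j → j < suc (suc last) → z ≢ seq j

  shortcut : ∀ {z} (H : Head z) (T : Tail z) →
    (∀ i j → i < suc (suc (Head.last H)) → j < suc (suc (Tail.last T)) → ¬ Adj (Head.seq H i) (Tail.seq T j)) →
    (∀ i j → i < suc (suc (Head.last H)) → j < suc (suc (Tail.last T)) → Head.seq H i ≢ Tail.seq T j) →
    IsSpanning (splice (Head.seq H) (suc (suc (Head.last H))) (cons z (Tail.seq T)))
               (suc (suc (Head.last H)) + suc (suc (suc (Tail.last T))))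
  shortcut {z} H T H≁T H≢T = record
    { path     = splice-path H.path (cons-path T.path T.attached T.detached T.avoids) H.attached H≁zT H≢zT
    ; 2≤length = s≤s (s≤s z≤n)
    ; start    = H.start
    ; end      = subst₂ (λ x y → PairIs x y Bottommost Rightmost) (sym penultimate) (sym ultimate) T.end }
    where
    module H = Head H
    module T = Tail T
    α = suc (suc H.last)
    H≁zT : ∀ i j → i < α → j < suc (suc (suc T.last)) → suc i < α + j → ¬ Adj (H.seq i) (cons z T.seq j)
    H≁zT i zero    i< _        i<j = H.detached i (≤-pred (subst (suc i <_) (+-identityʳ α) i<j))
    H≁zT i (suc j) i< (s≤s j<) _   = H≁T i j i< j<
    H≢zT : ∀ i j → i < α → j < suc (suc (suc T.last)) → H.seq i ≢ cons z T.seq j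
    H≢zT i zero    i< _        = H.avoids i i<
    H≢zT i (suc j) i< (s≤s j<) = H≢T i j i< j<
    G = splice H.seq α (cons z T.seq)
    penultimate : G (α + suc (suc (suc T.last)) ∸ 2) ≡ T.seq T.last
    penultimate = trans (cong G (+-∸-assoc α (s≤s (s≤s z≤n)))) (splice-suffix H.seq (cons z T.seq) α _)
    ultimate : G (α + suc (suc (suc T.last)) ∸ 1) ≡ T.seq (suc T.last)
    ultimate = trans (cong G (+-∸-assoc α (s≤s z≤n))) (splice-suffix H.seq (cons z T.seq) α _)

  []≔-isSpanning : ∀ {g m p z} → IsSpanning g m → 1 ≤ p → suc (suc (suc (suc p))) ≤ m →
    (∀ k → k < m → k ≢ suc p → z ≢ g k) → Adj (g p) z → Adj z (g (suc (suc p))) →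
    (∀ k → k < p → ¬ Adj (g k) z) → (∀ j → suc (suc (suc p)) ≤ j → j < m → ¬ Adj z (g j)) →
    IsSpanning (g [ suc p ]≔ z) m
  []≔-isSpanning {g} {m} {p} {z} sp 1≤p bound z≢g g~z z~g g≁z z≁g = record
    { path     = record { distinct = distinct′ ; consecutive = consecutive′ ; induced = induced′ }
    ; 2≤length = ≤-trans (s≤s (s≤s z≤n)) bound
    ; start    = subst₂ (λ x y → PairIs x y Leftmost Topmost)
                   (sym (unchanged λ ())) (sym (unchanged λ e → <⇒≢ 1≤p (suc-injective e))) start
    ; end      = subst₂ (λ x y → PairIs x y Bottommost Rightmost)
                   (sym (unchanged (>⇒≢ (∸-monoˡ-≤ 2 bound))))
                   (sym (unchanged (>⇒≢ (<⇒≤ (∸-monoˡ-≤ 1 bound))))) end }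
    where
    open IsSpanning sp
    h = g [ suc p ]≔ z
    updated : h (suc p) ≡ z
    updated = []≔-updated g (suc p) z
    unchanged : ∀ {k} → k ≢ suc p → h k ≡ g k
    unchanged = []≔-unchanged g (suc p) z
    distinct′ : ∀ i j → i < m → j < m → h i ≡ h j → i ≡ j
    distinct′ i j i< j< e with i ≟ suc p | j ≟ suc p
    ... | yes i≡ | yes j≡ = trans i≡ (sym j≡)
    ... | yes refl | no j≢ = contradiction (trans (sym updated) (trans e (unchanged j≢))) (z≢g j j< j≢)
    ... | no i≢ | yes refl = contradiction (trans (sym updated) (trans (sym e) (unchanged i≢))) (z≢g i i< i≢)
    ... | no i≢ | no j≢ = distinct i j i< j< (trans (sym (unchanged i≢)) (trans e (unchanged j≢)))
    consecutive′ : ∀ i → suc i < m → Adj (h i) (h (suc i))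
    consecutive′ i i< with i ≟ suc p | suc i ≟ suc p
    ... | yes refl | _ = subst₂ Adj (sym updated) (sym (unchanged (1+n≢n ∘ suc-injective))) z~g
    ... | no i≢ | yes refl = subst₂ Adj (sym (unchanged i≢)) (sym updated) g~z
    ... | no i≢ | no si≢ = subst₂ Adj (sym (unchanged i≢)) (sym (unchanged si≢)) (consecutive i i<)
    induced′ : ∀ i j → j < m → suc i < j → ¬ Adj (h i) (h j)
    induced′ i j j< i<j with i ≟ suc p | j ≟ suc p
    ... | yes refl | _ = subst₂ (λ x y → ¬ Adj x y) (sym updated)
                           (sym (unchanged (>⇒≢ (<⇒≤ i<j)))) (z≁g j i<j j<)
    ... | no i≢ | yes refl = subst₂ (λ x y → ¬ Adj x y) (sym (unchanged i≢)) (sym updated) (g≁z i (≤-pred i<j))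
    ... | no i≢ | no j≢ = subst₂ (λ x y → ¬ Adj x y) (sym (unchanged i≢)) (sym (unchanged j≢)) (induced i j j< i<j)

  isSpanning-cong : ∀ {f f′ m} → (∀ k → k < m → f k ≡ f′ k) → IsSpanning f m → IsSpanning f′ m
  isSpanning-cong {f} {f′} {m} f≗f′ sp = record
    { path     = record
      { distinct    = λ i j i< j< e → distinct i j i< j< (trans (f≗f′ i i<) (trans e (sym (f≗f′ j j<))))
      ; consecutive = λ i i< → subst₂ Adj (f≗f′ i (<⇒≤ i<)) (f≗f′ (suc i) i<) (consecutive i i<)
      ; induced     = λ i j j< i<j → subst₂ (λ x y → ¬ Adj x y)
                        (f≗f′ i (<-trans (<⇒≤ i<j) j<)) (f≗f′ j j<) (induced i j j< i<j) }
    ; 2≤length = 2≤length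
    ; start    = subst₂ (λ x y → PairIs x y Leftmost Topmost) (f≗f′ 0 (<⇒≤ 2≤length)) (f≗f′ 1 2≤length) start
    ; end      = subst₂ (λ x y → PairIs x y Bottommost Rightmost)
                   (f≗f′ (m ∸ 2) (∸-monoʳ-< {m} {2} {0} (s≤s z≤n) 2≤length))
                   (f≗f′ (m ∸ 1) (∸-monoʳ-< {m} {1} {0} (s≤s z≤n) (<⇒≤ 2≤length))) end }
    where open IsSpanning sp

reverse : {A : Set} → ℕ → (ℕ → A) → ℕ → A
reverse m f k = f (m ∸ suc k)

reverse-index< : ∀ {m k} → k < m → m ∸ suc k < m
reverse-index< k<m = ∸-monoʳ-< (s≤s z≤n) k<m

suc-reverse-index : ∀ {m k} → k < m → suc (m ∸ suc k) ≡ m ∸ k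
suc-reverse-index k<m = sym (+-∸-assoc 1 k<m)

reverse-index-involutive : ∀ {m k} → k < m → m ∸ suc (m ∸ suc k) ≡ k
reverse-index-involutive {m} k<m = trans (cong (m ∸_) (suc-reverse-index k<m)) (m∸[m∸n]≡n (<⇒≤ k<m))

reverse-reverse : {A : Set} {m k : ℕ} (f : ℕ → A) → k < m → reverse m f (m ∸ suc k) ≡ f k
reverse-reverse f k<m = cong f (reverse-index-involutive k<m)

reverse-[]≔ : {A : Set} {m k : ℕ} (g : ℕ → A) (z : A) → k < m →
  ∀ j → j < m → reverse m (reverse m g [ m ∸ suc k ]≔ z) j ≡ (g [ k ]≔ z) j
reverse-[]≔ {m = m} {k} g z k<m j j<m with j ≟ k
... | yes refl = trans ([]≔-updated (reverse m g) _ z) (sym ([]≔-updated g k z))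
... | no  j≢k  = trans ([]≔-unchanged (reverse m g) _ z mirrored≢)
                       (trans (reverse-reverse g j<m) (sym ([]≔-unchanged g k z j≢k)))
  where
  mirrored≢ : m ∸ suc j ≢ m ∸ suc k
  mirrored≢ e = j≢k (trans (sym (reverse-index-involutive j<m))
                     (trans (cong (λ x → m ∸ suc x) e) (reverse-index-involutive k<m)))

swap-PairIs : {A : Set} {a b : A} {U V : A → Set} → (U a × V b) ⊎ (V a × U b) → (V b × U a) ⊎ (U b × V a)
swap-PairIs (inj₁ (u , v)) = inj₁ (v , u)
swap-PairIs (inj₂ (v , u)) = inj₂ (u , v)

-- Flipping both orders is the point reflection of the matrix.
module Reversal {A : Set} (_<r_ _<c_ : Rel A 0ℓ) where
  open Oscillations _<r_ _<c_
  module Reflected = Oscillations (flip _<r_) (flip _<c_)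

  reverse-isSpanning : ∀ {f m} → IsSpanning f m → Reflected.IsSpanning (reverse m f) m
  reverse-isSpanning {f} {m} sp = record
    { path     = record { distinct = distinct′ ; consecutive = consecutive′ ; induced = induced′ }
    ; 2≤length = 2≤length
    ; start    = swap-PairIs {U = Bottommost} {V = Rightmost} end
    ; end      = subst₂ (λ x y → PairIs (f x) (f y) Topmost Leftmost)
                   (sym (reverse-index-involutive 2≤length))
                   (sym (reverse-index-involutive (<⇒≤ 2≤length)))
                   (swap-PairIs {U = Leftmost} {V = Topmost} start) }
    where
    open IsSpanning sp
    distinct′ : ∀ i j → i < m → j < m → reverse m f i ≡ reverse m f j → i ≡ j
    distinct′ i j i< j< e = suc-injective (∸-cancelˡ-≡ i< j<
      (distinct _ _ (reverse-index< i<) (reverse-index< j<) e))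
    consecutive′ : ∀ i → suc i < m → Reflected.Adj (reverse m f i) (reverse m f (suc i))
    consecutive′ i i< = subst (λ k → Adj (f (m ∸ suc (suc i))) (f k)) (suc-reverse-index i<)
      (consecutive (m ∸ suc (suc i)) (subst (_< m) (sym (suc-reverse-index i<)) (reverse-index< (<⇒≤ i<))))
    induced′ : ∀ i j → j < m → suc i < j → ¬ Reflected.Adj (reverse m f i) (reverse m f j)
    induced′ i j j< i<j = induced (m ∸ suc j) (m ∸ suc i) (reverse-index< (<-trans (<⇒≤ i<j) j<))
      (subst (_< m ∸ suc i) (sym (suc-reverse-index j<)) (∸-monoʳ-< i<j (<⇒≤ j<)))

module Geometry {A : Set} {_<r_ _<c_ : Rel A 0ℓ}
  (R : IsStrictTotalOrder _≡_ _<r_) (C : IsStrictTotalOrder _≡_ _<c_) where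
  open Oscillations _<r_ _<c_
  private
    module R = IsStrictTotalOrder R
    module C = IsStrictTotalOrder C

  <r⇒≢ : ∀ {x y} → x <r y → x ≢ y
  <r⇒≢ x<y x≡y = R.irrefl x≡y x<y

  <c⇒≢ : ∀ {x y} → x <c y → x ≢ y
  <c⇒≢ x<y x≡y = C.irrefl x≡y x<y

  >r⇒≢ : ∀ {x y} → y <r x → x ≢ y
  >r⇒≢ y<x x≡y = R.irrefl (sym x≡y) y<x

  <r-connex : ∀ {x y} → x ≢ y → x <r y ⊎ y <r x
  <r-connex {x} {y} x≢y with R.compare x y
  ... | tri< x<y _ _ = inj₁ x<y
  ... | tri≈ _ x≡y _ = contradiction x≡y x≢y
  ... | tri> _ _ y<x = inj₂ y<x

  <c-connex : ∀ {x y} → x ≢ y → x <c y ⊎ y <c x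
  <c-connex {x} {y} x≢y with C.compare x y
  ... | tri< x<y _ _ = inj₁ x<y
  ... | tri≈ _ x≡y _ = contradiction x≡y x≢y
  ... | tri> _ _ y<x = inj₂ y<x

  ≺-trans : ∀ {x y z} → x ≺ y → y ≺ z → x ≺ z
  ≺-trans (r₁ , c₁) (r₂ , c₂) = R.trans r₁ r₂ , C.trans c₁ c₂

  Adj-sym : ∀ {x y} → Adj x y → Adj y x
  Adj-sym (inj₁ p) = inj₂ p
  Adj-sym (inj₂ p) = inj₁ p

  Adj? : ∀ x y → Dec (Adj x y)
  Adj? x y = (y R.<? x ×-dec x C.<? y) ⊎-dec (x R.<? y ×-dec y C.<? x)

  ≺⇒¬Adj : ∀ {x y} → x ≺ y → ¬ Adj x y
  ≺⇒¬Adj (x<y , _) (inj₁ (y<x , _)) = R.asym x<y y<x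
  ≺⇒¬Adj (_ , x<y) (inj₂ (_ , y<x)) = C.asym x<y y<x

  Adj∧<r⇒>c : ∀ {x y} → Adj x y → x <r y → y <c x
  Adj∧<r⇒>c (inj₁ (y<x , _)) x<y = contradiction y<x (R.asym x<y)
  Adj∧<r⇒>c (inj₂ (_ , y<x)) _   = y<x

  Adj∧<c⇒>r : ∀ {x y} → Adj x y → x <c y → y <r x
  Adj∧<c⇒>r (inj₁ (y<x , _)) _   = y<x
  Adj∧<c⇒>r (inj₂ (_ , y<x)) x<y = contradiction y<x (C.asym x<y)

  ¬Adj∧<r⇒<c : ∀ {x y} → ¬ Adj x y → x ≢ y → x <r y → x <c y
  ¬Adj∧<r⇒<c x≁y x≢y x<y with <c-connex x≢y
  ... | inj₁ x<y′ = x<y′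
  ... | inj₂ y<x  = contradiction (inj₂ (x<y , y<x)) x≁y

  ¬Adj∧<c⇒<r : ∀ {x y} → ¬ Adj x y → x ≢ y → x <c y → x <r y
  ¬Adj∧<c⇒<r x≁y x≢y x<y with <r-connex x≢y
  ... | inj₁ x<y′ = x<y′
  ... | inj₂ y<x  = contradiction (inj₁ (y<x , x<y)) x≁y

  Leftmost⇒<c : ∀ {x y} → Leftmost x → x ≢ y → x <c y
  Leftmost⇒<c {y = y} left x≢y with <c-connex x≢y
  ... | inj₁ x<y = x<y
  ... | inj₂ y<x = contradiction y<x (left y)

  Topmost⇒<r : ∀ {x y} → Topmost x → x ≢ y → x <r y
  Topmost⇒<r {y = y} top x≢y with <r-connex x≢y
  ... | inj₁ x<y = x<y
  ... | inj₂ y<x = contradiction y<x (top y)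

  ≺-propagates : ∀ {x₀ x₁ x₂ x₃} → Adj x₀ x₁ → Adj x₁ x₂ → Adj x₂ x₃ →
    ¬ Adj x₀ x₃ → ¬ Adj x₁ x₃ → x₁ ≢ x₃ → x₀ ≺ x₂ → x₁ ≺ x₃
  ≺-propagates {x₀} {x₁} {x₂} {x₃} a₀₁ a₁₂ a₂₃ n₀₃ n₁₃ x₁≢x₃ (r₀₂ , c₀₂) with <r-connex x₁≢x₃
  ... | inj₁ r₁₃ = r₁₃ , ¬Adj∧<r⇒<c n₁₃ x₁≢x₃ r₁₃
  ... | inj₂ r₃₁ = contradiction (a₀₁ , a₁₂) impossible
    where
    c₃₁ : x₃ <c x₁
    c₃₁ = ¬Adj∧<r⇒<c (n₁₃ ∘ Adj-sym) (x₁≢x₃ ∘ sym) r₃₁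
    impossible : ¬ (Adj x₀ x₁ × Adj x₁ x₂)
    impossible (inj₁ (r₁₀ , _) , inj₁ (r₂₁ , _)) = R.asym r₀₂ (R.trans r₂₁ r₁₀)
    impossible (inj₂ (_ , c₁₀) , inj₂ (_ , c₂₁)) = C.asym c₀₂ (C.trans c₂₁ c₁₀)
    impossible (inj₁ (r₁₀ , _) , inj₂ (r₁₂ , _)) =
      let r₃₀ = R.trans r₃₁ r₁₀ in
      ≺⇒¬Adj (R.trans r₃₁ r₁₂ , C.trans (¬Adj∧<r⇒<c (n₀₃ ∘ Adj-sym) (<r⇒≢ r₃₀) r₃₀) c₀₂) (Adj-sym a₂₃)
    impossible (inj₂ (_ , c₁₀) , inj₁ (_ , c₁₂)) =
      let c₃₀ = C.trans c₃₁ c₁₀ in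
      ≺⇒¬Adj (R.trans (¬Adj∧<c⇒<r (n₀₃ ∘ Adj-sym) (<c⇒≢ c₃₀) c₃₀) r₀₂ , C.trans c₃₁ c₁₂) (Adj-sym a₂₃)

  module Spanning {f : ℕ → A} {L : ℕ} (sp : IsSpanning f L) where
    open IsSpanning sp

    distinct-at : ∀ {i j} → i < L → j < L → i ≢ j → f i ≢ f j
    distinct-at i< j< i≢j e = i≢j (distinct _ _ i< j< e)

    ≺-two-apart : ∀ a → suc (suc a) < L → f a ≺ f (suc (suc a))
    ≺-two-apart zero 2<L = from-start start
      where
      f₀≢f₂ = distinct-at (<⇒≤ (<⇒≤ 2<L)) 2<L λ ()
      f₀≁f₂ = induced 0 2 2<L ≤-refl
      from-start : PairIs (f 0) (f 1) Leftmost Topmost → f 0 ≺ f 2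
      from-start (inj₁ (left , _)) = let c = Leftmost⇒<c left f₀≢f₂ in ¬Adj∧<c⇒<r f₀≁f₂ f₀≢f₂ c , c
      from-start (inj₂ (top , _))  = let r = Topmost⇒<r top f₀≢f₂ in r , ¬Adj∧<r⇒<c f₀≁f₂ f₀≢f₂ r
    ≺-two-apart (suc a) a+3<L =
      ≺-propagates (consecutive a (<⇒≤ (<⇒≤ a+3<L))) (consecutive (suc a) (<⇒≤ a+3<L))
        (consecutive (suc (suc a)) a+3<L) (induced a _ a+3<L (n≤1+n _)) (induced (suc a) _ a+3<L ≤-refl)
        (distinct-at (<⇒≤ (<⇒≤ a+3<L)) a+3<L (<⇒≢ (m<n+m (suc a) {2} z<s)))
        (≺-two-apart a (<⇒≤ a+3<L))

    ≺-three-apart : ∀ a → suc (suc (suc a)) < L → f a ≺ f (suc (suc (suc a)))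
    ≺-three-apart a a+3<L = from-edge (consecutive a (<⇒≤ (<⇒≤ a+3<L))) (≺-two-apart (suc a) a+3<L)
      where
      f₀≢f₃ = distinct-at (<⇒≤ (<⇒≤ (<⇒≤ a+3<L))) a+3<L (<⇒≢ (m<n+m a {3} z<s))
      f₀≁f₃ = induced a _ a+3<L (n≤1+n _)
      from-edge : Adj (f a) (f (suc a)) → f (suc a) ≺ f (suc (suc (suc a))) → f a ≺ f (suc (suc (suc a)))
      from-edge (inj₁ (_ , c₀₁)) (_ , c₁₃) = let c₀₃ = C.trans c₀₁ c₁₃ in ¬Adj∧<c⇒<r f₀≁f₃ f₀≢f₃ c₀₃ , c₀₃
      from-edge (inj₂ (r₀₁ , _)) (r₁₃ , _) = let r₀₃ = R.trans r₀₁ r₁₃ in r₀₃ , ¬Adj∧<r⇒<c f₀≁f₃ f₀≢f₃ r₀₃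

    private
      ≺-at-offset : ∀ d a → d + suc (suc a) < L → f a ≺ f (d + suc (suc a))
      ≺-at-offset zero          a bound = ≺-two-apart a bound
      ≺-at-offset (suc zero)    a bound = ≺-three-apart a bound
      ≺-at-offset (suc (suc d)) a bound =
        ≺-trans (≺-at-offset d a (<⇒≤ (<⇒≤ bound))) (≺-two-apart (d + suc (suc a)) bound)

    ≺-at-distance : ∀ {a b} → suc (suc a) ≤ b → b < L → f a ≺ f b
    ≺-at-distance {a} {b} a+2≤b b<L =
      subst (λ k → f a ≺ f k) (m∸n+n≡m a+2≤b)
        (≺-at-offset (b ∸ suc (suc a)) a (subst (_< L) (sym (m∸n+n≡m a+2≤b)) b<L))

    after-upper : ∀ {i} → suc (suc (suc i)) < L → IsUpper (f i) (f (suc i)) (f (suc (suc i))) →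
      f (suc (suc (suc i))) <r f (suc (suc i)) × f (suc (suc i)) <c f (suc (suc (suc i)))
    after-upper i+3<L (_ , _ , _ , q<cu) =
      let q<cq₊ = C.trans q<cu (proj₂ (≺-at-distance ≤-refl i+3<L)) in
      Adj∧<c⇒>r (consecutive _ i+3<L) q<cq₊ , q<cq₊

  module Shortcuts {g : ℕ → A} {m : ℕ} (sp : IsSpanning g m) (minimal : IsMinimalLength m) (z : A) where
    open IsSpanning sp

    record EarlyHead : Set where
      field
        head   : Head z
        from-g : ∀ i → i < suc (suc (Head.last head)) →
                 Σ ℕ λ k → k ≤ suc (Head.last head) × Head.seq head i ≡ g k

    record LateTail : Set where
      field
        tail   : Tail z
        first  : ℕ
        length : m ≡ first + suc (suc (Tail.last tail))
        from-g : ∀ j → j < suc (suc (Tail.last tail)) →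
                 Σ ℕ λ l → first ≤ l × l < m × Tail.seq tail j ≡ g l

    -- Joining an early head to a late tail through z would give a shorter spanning oscillation.
    no-shortcut : (H : EarlyHead) (T : LateTail) →
      ¬ (suc (suc (suc (Head.last (EarlyHead.head H)))) < LateTail.first T)
    no-shortcut Hᵉ Tˡ gap = <⇒≱ shorter (minimal _ _ (shortcut H T H≁T H≢T))
      where
      open EarlyHead Hᵉ renaming (head to H; from-g to H-from-g)
      open LateTail Tˡ renaming (tail to T; from-g to T-from-g)
      module H = Head H
      module T = Tail T
      shorter : suc (suc H.last) + suc (suc (suc T.last)) < m
      shorter = subst (suc (suc H.last) + suc (suc (suc T.last)) <_) (sym length)
        (subst (_< first + suc (suc T.last)) (sym (+-suc (suc (suc H.last)) (suc (suc T.last))))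
          (+-monoˡ-< (suc (suc T.last)) gap))
      apart : ∀ {k l} → k ≤ suc H.last → first ≤ l → suc k < l
      apart k≤ ≤l = ≤-trans (s≤s (s≤s k≤)) (≤-trans (<⇒≤ gap) ≤l)
      H≁T : ∀ i j → i < suc (suc H.last) → j < suc (suc T.last) → ¬ Adj (H.seq i) (T.seq j)
      H≁T i j i< j< with H-from-g i i< | T-from-g j j<
      ... | k , k≤ , eₖ | l , ≤l , l<m , eₗ =
            subst₂ (λ x y → ¬ Adj x y) (sym eₖ) (sym eₗ) (induced k l l<m (apart k≤ ≤l))
      H≢T : ∀ i j → i < suc (suc H.last) → j < suc (suc T.last) → H.seq i ≢ T.seq j
      H≢T i j i< j< e with H-from-g i i< | T-from-g j j<
      ... | k , k≤ , eₖ | l , ≤l , l<m , eₗ =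
            <⇒≢ k<l (distinct k l (<-trans k<l l<m) l<m (trans (sym eₖ) (trans e eₗ)))
        where k<l = <⇒≤ (apart k≤ ≤l)

  -- z is an obstruction of type (i) at the upper entry g (suc i); it replaces g (suc (suc i)).
  module LowerReplacement {g : ℕ → A} {m : ℕ} (sp : IsSpanning g m) (minimal : IsMinimalLength m)
    {i : ℕ} (i+3<m : suc (suc (suc i)) < m) (upper : IsUpper (g i) (g (suc i)) (g (suc (suc i))))
    {z : A} (z-below : g (suc (suc i)) <r z) (z-left : z <c g (suc i)) where
    open IsSpanning sp
    open Spanning sp
    open Shortcuts sp minimal z

    u q : ℕ
    u = suc i
    q = suc u

    u<rq : g u <r g q
    u<rq = proj₁ (proj₂ (proj₂ upper))

    q₊<rq : g (suc q) <r g q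
    q₊<rq = proj₁ (after-upper i+3<m upper)

    q<cq₊ : g q <c g (suc q)
    q<cq₊ = proj₂ (after-upper i+3<m upper)

    above-z : ∀ {k} → suc (suc k) ≤ q → g k <r z
    above-z k+2≤q = R.trans (proj₁ (≺-at-distance k+2≤q (<⇒≤ i+3<m))) z-below

    right-of-z : ∀ {k} → suc q ≤ k → k < m → z <c g k
    right-of-z q<k k<m = C.trans z-left (proj₂ (≺-at-distance q<k k<m))

    z-fresh : ∀ k → k < m → k ≢ q → z ≢ g k
    z-fresh k k<m k≢q with <-cmp k q
    ... | tri≈ _ k≡q _ = contradiction k≡q k≢q
    ... | tri> _ _ q<k = <c⇒≢ (right-of-z q<k k<m)
    ... | tri< k<q _ _ with m<1+n⇒m<n∨m≡n k<q
    ...   | inj₁ k<u  = >r⇒≢ (above-z (s≤s k<u))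
    ...   | inj₂ refl = >r⇒≢ (R.trans u<rq z-below)

    u~z : Adj (g u) z
    u~z = inj₂ (R.trans u<rq z-below , z-left)

    z~q₊ : Adj z (g (suc q))
    z~q₊ = inj₁ (R.trans q₊<rq z-below , right-of-z ≤-refl i+3<m)

    -- z lies below g q and g q lies left of g (q + 1), so these two are not the final pair.
    q+2<m : suc (suc q) < m
    q+2<m with suc (suc q) <? m
    ... | yes q+2<m = q+2<m
    ... | no q+2≮m = contradiction (subst (λ n → PairIs (g (n ∸ 2)) (g (n ∸ 1)) Bottommost Rightmost) m≡ end) not-final
      where
      m≡ : m ≡ suc (suc q)
      m≡ = ≤-antisym (≤-pred (≰⇒> q+2≮m)) i+3<m
      not-final : ¬ PairIs (g q) (g (suc q)) Bottommost Rightmost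
      not-final (inj₁ (bottom , _)) = bottom z z-below
      not-final (inj₂ (right , _))  = right (g (suc q)) q<cq₊

    -- If z is adjacent to g 0 then g 0 is topmost, so the shortcut may start with g 1 , g 0.
    g₀-topmost : Adj (g 0) z → Topmost (g 0) × Leftmost (g 1)
    g₀-topmost g₀~z with start
    ... | inj₁ (left , _) = contradiction (Adj∧<r⇒>c g₀~z (above-z (s≤s (s≤s z≤n)))) (left z)
    ... | inj₂ top-left   = top-left

    head-from : ∀ a → suc a ≤ u → Adj (g (suc a)) z → (∀ k → k < suc a → ¬ Adj (g k) z) → EarlyHead
    head-from a a<u g~z before = record
      { head   = record
        { seq      = g
        ; last     = a
        ; path     = restrict (≤-trans (s≤s a<u) (<⇒≤ (<⇒≤ i+3<m))) path
        ; start    = start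
        ; attached = g~z
        ; detached = before
        ; avoids   = λ k k< e → z-fresh k (<-trans (<-≤-trans k< (s≤s a<u)) (<⇒≤ i+3<m))
                                  (<⇒≢ (<-≤-trans k< (s≤s a<u))) (sym e) }
      ; from-g = λ k k< → k , ≤-pred k< , refl }

    head-swapped : Adj (g 0) z → EarlyHead × 1 ≤ i
    head-swapped g₀~z = record
      { head   = record
        { seq      = pair (g 1) (g 0)
        ; last     = 0
        ; path     = pair-path (Adj-sym (consecutive 0 1<m)) (distinct-at 1<m 0<m λ ())
        ; start    = inj₁ (left , top)
        ; attached = g₀~z
        ; detached = λ { zero _ g₁~z → left z (Adj∧<r⇒>c g₁~z (above-z (s≤s (s≤s 1≤i)))) ; (suc _) (s≤s ()) }
        ; avoids   = λ { zero _ e → z-fresh 1 1<m (λ ()) (sym e)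
                       ; (suc zero) _ e → z-fresh 0 0<m (λ ()) (sym e)
                       ; (suc (suc _)) (s≤s (s≤s ())) } }
      ; from-g = λ { zero _ → 1 , ≤-refl , refl ; (suc zero) _ → 0 , z≤n , refl ; (suc (suc _)) (s≤s (s≤s ())) } }
      , 1≤i
      where
      top = proj₁ (g₀-topmost g₀~z)
      left = proj₂ (g₀-topmost g₀~z)
      1<m : 1 < m
      1<m = <-≤-trans (s≤s (s≤s z≤n)) (<⇒≤ i+3<m)
      0<m : 0 < m
      0<m = <⇒≤ 1<m
      1≤i : 1 ≤ i
      1≤i = n≢0⇒n>0 λ i≡0 → top (g 1) (subst (λ k → g (suc k) <r g k) i≡0 (proj₁ upper))

    tail-from : ∀ b e → m ≡ b + suc (suc e) → suc q ≤ b → Adj z (g b) →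
                (∀ k → b < k → k < m → ¬ Adj z (g k)) → LateTail
    tail-from b e m≡ q<b z~b after = record
      { tail   = record
        { seq      = λ j → g (b + j)
        ; last     = e
        ; path     = shift b _ (subst (IsInducedPath g) m≡ path)
        ; end      = subst₂ (λ x y → PairIs (g x) (g y) Bottommost Rightmost)
                       (trans (cong (_∸ 2) m≡) (+-∸-assoc b (s≤s (s≤s z≤n))))
                       (trans (cong (_∸ 1) m≡) (+-∸-assoc b (s≤s z≤n))) end
        ; attached = subst (λ k → Adj z (g k)) (sym (+-identityʳ b)) z~b
        ; detached = λ j 1≤j j< → after (b + j) (m<m+n b 1≤j) (index< j<)
        ; avoids   = λ j j< → z-fresh (b + j) (index< j<) (>⇒≢ (≤-trans q<b (m≤m+n b j))) }
      ; first  = b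
      ; length = m≡
      ; from-g = λ j j< → b + j , m≤m+n b j , index< j< , refl }
      where
      index< : ∀ {j} → j < suc (suc e) → b + j < m
      index< j< = subst (b + _ <_) (sym m≡) (+-monoʳ-< b j<)

    -- If z is adjacent to g (m - 1) then g (m - 2) is bottommost,
    -- so the shortcut may end with g (m - 1) , g (m - 2).
    tail-swapped : ∀ c → m ≡ suc (suc c) → suc q ≤ suc c → Adj z (g (suc c)) → LateTail × suc q < c
    tail-swapped c m≡ q<c₊ z~c₊ = record
      { tail   = record
        { seq      = pair (g (suc c)) (g c)
        ; last     = 0
        ; path     = pair-path (Adj-sym (consecutive c c₊<m)) (distinct-at c₊<m c<m 1+n≢n)
        ; end      = inj₂ (right , bottom)
        ; attached = z~c₊
        ; detached = λ { (suc zero) _ _ z~c → bottom z (Adj∧<c⇒>r z~c (right-of-z (<⇒≤ q₊<c) c<m))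
                       ; (suc (suc _)) _ (s≤s (s≤s ())) }
        ; avoids   = λ { zero _ → z-fresh (suc c) c₊<m (>⇒≢ q<c₊)
                       ; (suc zero) _ → z-fresh c c<m (>⇒≢ (<⇒≤ q₊<c))
                       ; (suc (suc _)) (s≤s (s≤s ())) } }
      ; first  = c
      ; length = trans m≡ (+-comm 2 c)
      ; from-g = λ { zero _ → suc c , n≤1+n c , c₊<m , refl
                   ; (suc zero) _ → c , ≤-refl , c<m , refl
                   ; (suc (suc _)) (s≤s (s≤s ())) } }
      , q₊<c
      where
      c₊<m : suc c < m
      c₊<m = subst (suc c <_) (sym m≡) ≤-refl
      c<m : c < m
      c<m = <⇒≤ c₊<m
      bottom-right : Bottommost (g c) × Rightmost (g (suc c))
      bottom-right with subst (λ n → PairIs (g (n ∸ 2)) (g (n ∸ 1)) Bottommost Rightmost) m≡ end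
      ... | inj₁ br = br
      ... | inj₂ (_ , bottom) = contradiction (Adj∧<c⇒>r z~c₊ (right-of-z q<c₊ c₊<m)) (bottom z)
      bottom = proj₁ bottom-right
      right = proj₂ bottom-right
      q₊<c : suc q < c
      q₊<c = ≤∧≢⇒< (≤-pred (≤-pred (subst (suc (suc q) <_) m≡ q+2<m)))
                   (λ e → bottom (g q) (subst (λ k → g k <r g q) e q₊<rq))

    attachment : EarlyHead → ℕ
    attachment H = suc (Head.last (EarlyHead.head H))

    head-at : ∀ {a} → a ≤ u → Adj (g a) z → (∀ k → k < a → ¬ Adj (g k) z) →
      Σ EarlyHead λ H → attachment H ≤ u × (a < u → attachment H < u)
    head-at {zero}  _   g₀~z _      = let (H , 1≤i) = head-swapped g₀~z in H , s≤s z≤n , λ _ → s≤s 1≤i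
    head-at {suc a} a<u g~z  before = head-from a a<u g~z before , a<u , λ a<u → a<u

    tail-at : ∀ {b} → suc q ≤ b → b < m → Adj z (g b) → (∀ k → b < k → k < m → ¬ Adj z (g k)) →
      Σ LateTail λ T → suc q ≤ LateTail.first T × (suc q < b → suc q < LateTail.first T)
    tail-at {suc c} q<b b<m z~b after with suc (suc c) <? m
    ... | yes b+1<m = let (e , b+2+e≡m) = m≤n⇒∃[o]m+o≡n b+1<m
                          m≡ = trans (sym b+2+e≡m) (sym (cong suc (trans (+-suc c (suc e)) (cong suc (+-suc c e)))))
                      in tail-from (suc c) e m≡ q<b z~b after , q<b , λ q<b → q<b
    ... | no b+1≮m = let (T , q₊<c) = tail-swapped c (≤-antisym (≮⇒≥ b+1≮m) b<m) q<b z~b in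
                     T , <⇒≤ q₊<c , λ _ → q₊<c

    gap : ∀ {l f} → l ≤ u → suc q ≤ f → l < u ⊎ suc q < f → suc (suc l) < f
    gap l≤u q<f (inj₁ l<u) = ≤-trans (s≤s (s≤s l<u)) q<f
    gap l≤u _   (inj₂ q₊<f) = ≤-<-trans (s≤s (s≤s l≤u)) q₊<f

    attachments-tight : ∀ {a b} → a ≤ u → Adj (g a) z → (∀ k → k < a → ¬ Adj (g k) z) →
      suc q ≤ b → b < m → Adj z (g b) → (∀ k → b < k → k < m → ¬ Adj z (g k)) →
      ¬ (a < u ⊎ suc q < b)
    attachments-tight a≤u g~z before q<b b<m z~g after slack
      with head-at a≤u g~z before | tail-at q<b b<m z~g after
    ... | H , h≤u , early | T , q<f , late = no-shortcut H T (gap h≤u q<f (Sum.map early late slack))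

    isolated : (∀ k → k < u → ¬ Adj (g k) z) × (∀ j → suc (suc q) ≤ j → j < m → ¬ Adj z (g j))
    isolated with least-witness (λ k → Adj? (g k) z) u~z | greatest-witness (λ k → Adj? z (g k)) m i+3<m z~q₊
    ... | a , a≤u , g~z , before | b , q<b , b<m , z~g , after = earlier , later
      where
      tight = attachments-tight a≤u g~z before q<b b<m z~g after
      earlier : ∀ k → k < u → ¬ Adj (g k) z
      earlier k k<u with a <? u
      ... | yes a<u = contradiction (inj₁ a<u) tight
      ... | no  a≮u = before k (<-≤-trans k<u (≮⇒≥ a≮u))
      later : ∀ j → suc (suc q) ≤ j → j < m → ¬ Adj z (g j)
      later j q₊<j j<m with suc q <? b
      ... | yes q₊<b = contradiction (inj₂ q₊<b) tight
      ... | no  q₊≮b = after j (≤-trans (s≤s (≮⇒≥ q₊≮b)) q₊<j) j<m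

    replaced : IsSpanning (g [ q ]≔ z) m
    replaced = []≔-isSpanning sp (s≤s z≤n) q+2<m z-fresh u~z z~q₊ (proj₁ isolated) (proj₂ isolated)

module UpperReplacement {A : Set} {_<r_ _<c_ : Rel A 0ℓ}
  (R : IsStrictTotalOrder _≡_ _<r_) (C : IsStrictTotalOrder _≡_ _<c_) where
  open Oscillations _<r_ _<c_
  open Reversal _<r_ _<c_
  open Reversal (flip _<r_) (flip _<c_) using () renaming (reverse-isSpanning to unreverse-isSpanning)
  open Geometry R C using (module Spanning)
  module Reflected-geometry = Geometry (Flip.isStrictTotalOrder R) (Flip.isStrictTotalOrder C)

  upper-replaced : ∀ {g m} → IsSpanning g m → IsMinimalLength m →
    ∀ {i} → suc (suc (suc i)) < m → IsUpper (g i) (g (suc i)) (g (suc (suc i))) →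
    ∀ {z} → z <r g (suc i) → g (suc (suc i)) <c z → 1 ≤ i × IsSpanning (g [ suc i ]≔ z) m
  upper-replaced {g} {m} sp minimal {i} i+3<m upper@(_ , _ , u<rq , q<cu) {z} z-above z-right =
    1≤i , isSpanning-cong (reverse-[]≔ g z u<m)
            (unreverse-isSpanning (subst (λ k → Reflected.IsSpanning (g′ [ k ]≔ z) m) e₂ L.replaced))
    where
    open Spanning sp
    g′ = reverse m g
    e = m ∸ suc (suc (suc (suc i)))
    u<m : suc i < m
    u<m = <⇒≤ (<⇒≤ i+3<m)
    e₁ : suc e ≡ m ∸ suc (suc (suc i))
    e₁ = suc-reverse-index i+3<m
    e₂ : suc (suc e) ≡ m ∸ suc (suc i)
    e₂ = trans (cong suc e₁) (suc-reverse-index (<⇒≤ i+3<m))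
    e+3<m : suc (suc (suc e)) < m
    e+3<m = subst (_< m) (sym (trans (cong suc e₂) (suc-reverse-index u<m))) (reverse-index< (<⇒≤ u<m))
    g′≡g : ∀ {k j} → k ≡ m ∸ suc j → j < m → g′ k ≡ g j
    g′≡g {j = j} refl j<m = reverse-reverse g j<m
    q-lower = after-upper i+3<m upper
    upper′ : Reflected.IsUpper (g′ e) (g′ (suc e)) (g′ (suc (suc e)))
    upper′ = subst₂ (λ x y → Reflected.IsUpper x y (g′ (suc (suc e))))
               (sym (g′≡g refl i+3<m)) (sym (g′≡g e₁ (<⇒≤ i+3<m)))
               (subst (λ w → Reflected.IsUpper (g (suc (suc (suc i)))) (g (suc (suc i))) w) (sym (g′≡g e₂ u<m))
                 (proj₁ q-lower , proj₂ q-lower , u<rq , q<cu))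
    minimal′ : Reflected.IsMinimalLength m
    minimal′ m′ f sp′ = minimal m′ (reverse m′ f) (unreverse-isSpanning sp′)
    module L = Reflected-geometry.LowerReplacement (reverse-isSpanning sp) minimal′ e+3<m upper′
                 (subst (z <r_) (sym (g′≡g e₂ u<m)) z-above)
                 (subst (_<c z) (sym (g′≡g e₁ (<⇒≤ i+3<m))) z-right)
    -- For i = 0 the replaced entry g 1 would be among the last two entries of the reversed oscillation.
    1≤i : 1 ≤ i
    1≤i = n≢0⇒n>0 λ i≡0 → <⇒≱ (subst (λ k → suc (suc k) < m) (trans e₂ (cong (λ j → m ∸ suc (suc j)) i≡0)) L.q+2<m)
                                  (m≤n+m∸n m 2)

∑< : ℕ → (ℕ → ℕ) → ℕ
∑< zero    F = 0
∑< (suc L) F = ∑< L F + F L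

∑<-mono-≤ : ∀ {F G} L → (∀ k → k < L → F k ≤ G k) → ∑< L F ≤ ∑< L G
∑<-mono-≤ zero    _   = z≤n
∑<-mono-≤ (suc L) F≤G = +-mono-≤ (∑<-mono-≤ L (λ k k< → F≤G k (m<n⇒m<1+n k<))) (F≤G L ≤-refl)

∑<-mono-< : ∀ {F G} L {q} → (∀ k → k < L → F k ≤ G k) → q < L → F q < G q → ∑< L F < ∑< L G
∑<-mono-< (suc L) F≤G q<L Fq<Gq with m<1+n⇒m<n∨m≡n q<L
... | inj₁ q<L′ = +-mono-<-≤ (∑<-mono-< L (λ k k< → F≤G k (m<n⇒m<1+n k<)) q<L′ Fq<Gq) (F≤G L ≤-refl)
... | inj₂ refl = +-mono-≤-< (∑<-mono-≤ L (λ k k< → F≤G k (m<n⇒m<1+n k<))) Fq<Gq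

∑<-≤-* : ∀ {F b} L → (∀ k → F k ≤ b) → ∑< L F ≤ L * b
∑<-≤-* zero    _    = z≤n
∑<-≤-* {b = b} (suc L) F≤b = ≤-trans (+-mono-≤ (∑<-≤-* L F≤b) (F≤b L)) (≤-reflexive (+-comm (L * b) b))

∣-∣-moves-away : ∀ {a b c} → (a < b × b < c) ⊎ (c < b × b < a) → ∣ a - b ∣ < ∣ a - c ∣
∣-∣-moves-away (inj₁ (a<b , b<c)) =
  subst₂ _<_ (sym (m≤n⇒∣m-n∣≡n∸m (<⇒≤ a<b))) (sym (m≤n⇒∣m-n∣≡n∸m (<⇒≤ (<-trans a<b b<c))))
    (∸-monoˡ-< b<c (<⇒≤ a<b))
∣-∣-moves-away (inj₂ (c<b , b<a)) =
  subst₂ _<_ (sym (m≤n⇒∣n-m∣≡n∸m (<⇒≤ b<a))) (sym (m≤n⇒∣n-m∣≡n∸m (<⇒≤ (<-trans c<b b<a))))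
    (∸-monoʳ-< c<b (<⇒≤ b<a))

module PermutationMatrix {n : ℕ} (P : PermMatrix n) where

  _<r_ _<c_ : Rel (Fin n) 0ℓ
  x <r y = x Fin.< y
  x <c y = P ⟨$⟩ʳ x Fin.< P ⟨$⟩ʳ y

  rows : IsStrictTotalOrder _≡_ _<r_
  rows = Fin.<-isStrictTotalOrder

  cols : IsStrictTotalOrder _≡_ _<c_
  cols = isStrictTotalOrderᶜ record { isEquivalence = isEquivalence ; trans = <-trans ; compare = compare }
    where
    compare : ∀ x y → Tri (x <c y) (x ≡ y) (y <c x)
    compare x y with Fin.<-cmp (P ⟨$⟩ʳ x) (P ⟨$⟩ʳ y)
    ... | tri< a ¬b ¬c = tri< a (¬b ∘ cong (P ⟨$⟩ʳ_)) ¬c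
    ... | tri≈ ¬a b ¬c = tri≈ ¬a (Injection.injective (↔⇒↣ P) b) ¬c
    ... | tri> ¬a ¬b c = tri> ¬a (¬b ∘ cong (P ⟨$⟩ʳ_)) c

  open Oscillations _<r_ _<c_
  open Geometry rows cols using (module LowerReplacement)
  open UpperReplacement rows cols using (upper-replaced)
  private
    module R = IsStrictTotalOrder rows
    module C = IsStrictTotalOrder cols

  get : ∀ {m} → Vec (Fin n) m → Fin n → ℕ → Fin n
  get []       d _       = d
  get (x ∷ xs) d zero    = x
  get (x ∷ xs) d (suc i) = get xs d i

  at-get : ∀ {m} (xs : Vec (Fin n) m) d i (p : i < m) → at P xs i p ≡ get xs d i
  at-get (x ∷ xs) d zero    p       = refl
  at-get (x ∷ xs) d (suc i) (s≤s p) = at-get xs d i p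

  table : ∀ m → (ℕ → Fin n) → Vec (Fin n) m
  table m h = tabulate (h ∘ toℕ)

  at-table : ∀ {m} (h : ℕ → Fin n) i (p : i < m) → at P (table m h) i p ≡ h i
  at-table h i p = trans (lookup∘tabulate _ (Fin.fromℕ< p)) (cong h (toℕ-fromℕ< p))

  PairIs-map : ∀ {a b} {U V U′ V′ : Fin n → Set} → (∀ {x} → U x → U′ x) → (∀ {x} → V x → V′ x) →
    PairIs a b U V → PairIs a b U′ V′
  PairIs-map f g = Sum.map (Product.map f g) (Product.map g f)

  -- Defs states extremality with ≤, the development as the absence of a strictly smaller entry.
  fromDefs : ∀ {m} (X : Vec (Fin n) m) d → Defs.IsSpanningOscillation P X → IsSpanning (get X d) m
  fromDefs {m} X d sp = record
    { path     = record
      { distinct    = λ i j p q e → distinct i j p q (trans (at-get X d i p) (trans e (sym (at-get X d j q))))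
      ; consecutive = λ i q → subst₂ Adj (at-get X d i (<⇒≤ q)) (at-get X d (suc i) q) (consec i (<⇒≤ q) q)
      ; induced     = λ i j q i<j → let p = <-trans (<⇒≤ i<j) q in
                        subst₂ (λ a b → ¬ Adj a b) (at-get X d i p) (at-get X d j q) (induced i j p q i<j) }
    ; 2≤length = len≥2
    ; start    = PairIs-map {U = Defs.IsLeftmost P} {V = Defs.IsTopmost P} (λ l y → ≤⇒≯ (l y)) (λ t y → ≤⇒≯ (t y))
                   (subst₂ (λ a b → Defs.PairIs P a b (Defs.IsLeftmost P) (Defs.IsTopmost P))
                     (at-get X d 0 0<m) (at-get X d 1 len≥2) (start 0<m len≥2))
    ; end      = PairIs-map {U = Defs.IsBottommost P} {V = Defs.IsRightmost P} (λ b y → ≤⇒≯ (b y)) (λ r y → ≤⇒≯ (r y))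
                   (subst₂ (λ a b → Defs.PairIs P a b (Defs.IsBottommost P) (Defs.IsRightmost P))
                     (at-get X d (m ∸ 2) m-2<m) (at-get X d (m ∸ 1) m-1<m) (end m-2<m m-1<m)) }
    where
    open Defs.IsSpanningOscillation sp
    open Defs.IsOscillation osc
    0<m : 0 < m
    0<m = <⇒≤ len≥2
    m-2<m : m ∸ 2 < m
    m-2<m = reverse-index< len≥2
    m-1<m : m ∸ 1 < m
    m-1<m = reverse-index< 0<m

  toDefs : ∀ {m} (h : ℕ → Fin n) → IsSpanning h m → Defs.IsSpanningOscillation P (table m h)
  toDefs {m} h sp = record
    { osc    = record
      { distinct = λ i j p q e → distinct i j p q (trans (sym (at-table h i p)) (trans e (at-table h j q)))
      ; consec   = λ i p q → subst₂ (Defs.Adj P) (sym (at-table h i p)) (sym (at-table h (suc i) q)) (consecutive i q)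
      ; induced  = λ i j p q i<j → subst₂ (λ a b → ¬ Defs.Adj P a b) (sym (at-table h i p)) (sym (at-table h j q))
                                     (induced i j q i<j) }
    ; len≥2  = 2≤length
    ; start  = λ p q → subst₂ (λ a b → Defs.PairIs P a b (Defs.IsLeftmost P) (Defs.IsTopmost P))
                          (sym (at-table h 0 p)) (sym (at-table h 1 q))
                          (PairIs-map {U = Leftmost} {V = Topmost} (λ l y → ≮⇒≥ (l y)) (λ t y → ≮⇒≥ (t y)) start)
    ; end    = λ p q → subst₂ (λ a b → Defs.PairIs P a b (Defs.IsBottommost P) (Defs.IsRightmost P))
                          (sym (at-table h (m ∸ 2) p)) (sym (at-table h (m ∸ 1) q))
                          (PairIs-map {U = Bottommost} {V = Rightmost} (λ b y → ≮⇒≥ (b y)) (λ r y → ≮⇒≥ (r y)) end) }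
    where open IsSpanning sp

  isTall-toDefs : ∀ {m} (h : ℕ → Fin n) → IsTall h m → Defs.IsTall P (table m h)
  isTall-toDefs {m} h tall i p q r i+3<m
    rewrite at-table {m} h i p | at-table {m} h (suc i) q | at-table {m} h (suc (suc i)) r = tall i i+3<m

  module Tallification {m : ℕ} (minimal : IsMinimalLength m) where

    ObstructionAt : (ℕ → Fin n) → ℕ → Set
    ObstructionAt h i = suc (suc (suc i)) < m × IsUpper (h i) (h (suc i)) (h (suc (suc i))) ×
      ((Σ (Fin n) λ z → h (suc (suc i)) <r z × z <c h (suc i)) ⊎ (Σ (Fin n) λ z → z <r h (suc i) × h (suc (suc i)) <c z))

    obstructionAt? : ∀ h i → Dec (ObstructionAt h i)
    obstructionAt? h i = suc (suc (suc i)) <? m ×-dec upper? ×-dec (any? type-i? ⊎-dec any? type-ii?)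
      where
      x₀ = h i
      x₁ = h (suc i)
      x₂ = h (suc (suc i))
      upper? = x₁ R.<? x₀ ×-dec x₀ C.<? x₁ ×-dec x₁ R.<? x₂ ×-dec x₂ C.<? x₁
      type-i? = λ z → x₂ R.<? z ×-dec z C.<? x₁
      type-ii? = λ z → z R.<? x₁ ×-dec x₂ C.<? z

    tall-or-obstructed : ∀ h → IsTall h m ⊎ Σ ℕ (ObstructionAt h)
    tall-or-obstructed h with any? (λ (i : Fin m) → obstructionAt? h (toℕ i))
    ... | yes (i , obstruction) = inj₂ (toℕ i , obstruction)
    ... | no  none = inj₁ λ i i+3<m upper →
          let none-at = λ obstruction → none (Fin.fromℕ< (<-trans (m<n+m i {3} z<s) i+3<m) ,
                          subst (ObstructionAt h) (sym (toℕ-fromℕ< _)) (i+3<m , upper , obstruction)) in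
          (λ z blocks → none-at (inj₁ (z , blocks))) , (λ z blocks → none-at (inj₂ (z , blocks)))

    rowGap : Fin n → Fin n → ℕ
    rowGap x y = ∣ toℕ x - toℕ y ∣

    height : (ℕ → Fin n) → ℕ
    height h = ∑< (pred m) λ k → rowGap (h k) (h (suc k))

    height-bounded : ∀ h → height h ≤ pred m * n
    height-bounded h = ∑<-≤-* (pred m) λ k →
      ≤-trans (∣m-n∣≤m⊔n (toℕ (h k)) (toℕ (h (suc k)))) (⊔-lub (<⇒≤ (toℕ<n (h k))) (<⇒≤ (toℕ<n (h (suc k)))))

    Beyond : Fin n → Fin n → Fin n → Set
    Beyond a b z = (a <r b × b <r z) ⊎ (z <r b × b <r a)

    height-[]≔ : ∀ h p z → suc (suc p) < m →
      Beyond (h p) (h (suc p)) z → Beyond (h (suc (suc p))) (h (suc p)) z → height h < height (h [ suc p ]≔ z)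
    height-[]≔ h p z p+2<m left right = ∑<-mono-< (pred m) grows (suc[m]≤n⇒m≤pred[n] p+2<m) second
      where
      h′ = h [ suc p ]≔ z
      at-p : h′ p ≡ h p
      at-p = []≔-unchanged h (suc p) z (<⇒≢ (n<1+n p))
      at-p+1 : h′ (suc p) ≡ z
      at-p+1 = []≔-updated h (suc p) z
      at-p+2 : h′ (suc (suc p)) ≡ h (suc (suc p))
      at-p+2 = []≔-unchanged h (suc p) z 1+n≢n
      first : rowGap (h p) (h (suc p)) < rowGap (h′ p) (h′ (suc p))
      first = subst (rowGap (h p) (h (suc p)) <_) (sym (cong₂ rowGap at-p at-p+1)) (∣-∣-moves-away left)
      second : rowGap (h (suc p)) (h (suc (suc p))) < rowGap (h′ (suc p)) (h′ (suc (suc p)))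
      second = subst (rowGap (h (suc p)) (h (suc (suc p))) <_) (sym (cong₂ rowGap at-p+1 at-p+2))
        (subst₂ _<_ (∣-∣-comm (toℕ (h (suc (suc p)))) _) (∣-∣-comm (toℕ (h (suc (suc p)))) _) (∣-∣-moves-away right))
      grows : ∀ k → k < pred m → rowGap (h k) (h (suc k)) ≤ rowGap (h′ k) (h′ (suc k))
      grows k _ with k ≟ p | k ≟ suc p
      ... | yes refl | _        = <⇒≤ first
      ... | no _     | yes refl = <⇒≤ second
      ... | no k≢p   | no k≢p+1 = ≤-reflexive (sym (cong₂ rowGap ([]≔-unchanged h (suc p) z k≢p+1)
                                                                ([]≔-unchanged h (suc p) z (k≢p ∘ suc-injective))))

    AgreeAtEnds : (ℕ → Fin n) → (ℕ → Fin n) → Set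
    AgreeAtEnds g h = ∀ k → k < 2 ⊎ m ∸ 2 ≤ k → h k ≡ g k

    []≔-agreeAtEnds : ∀ g {q} z → 2 ≤ q → suc (suc (suc q)) ≤ m → AgreeAtEnds g (g [ q ]≔ z)
    []≔-agreeAtEnds g {q} z 2≤q q+3≤m k k∈ = []≔-unchanged g q z ([ before , after ]′ k∈)
      where
      before : k < 2 → k ≢ q
      before k<2 = <⇒≢ (<-≤-trans k<2 2≤q)
      after : m ∸ 2 ≤ k → k ≢ q
      after m-2≤k = >⇒≢ (<-≤-trans (∸-monoˡ-≤ 2 q+3≤m) m-2≤k)

    improve : ∀ {h} → IsSpanning h m → Σ ℕ (ObstructionAt h) →
      Σ (ℕ → Fin n) λ h′ → IsSpanning h′ m × AgreeAtEnds h h′ × height h < height h′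
    improve {h} sp (i , i+3<m , upper , inj₁ (z , below , left)) =
      h [ suc (suc i) ]≔ z , L.replaced , []≔-agreeAtEnds h z (s≤s (s≤s z≤n)) L.q+2<m ,
      height-[]≔ h (suc i) z i+3<m (inj₁ (proj₁ (proj₂ (proj₂ upper)) , below)) (inj₁ (L.q₊<rq , below))
      where module L = LowerReplacement sp minimal i+3<m upper below left
    improve {h} sp (i , i+3<m , upper , inj₂ (z , above , right)) =
      let (1≤i , sp′) = upper-replaced sp minimal i+3<m upper above right in
      h [ suc i ]≔ z , sp′ , []≔-agreeAtEnds h z (s≤s 1≤i) i+3<m ,
      height-[]≔ h i z (<⇒≤ i+3<m) (inj₂ (above , proj₁ upper)) (inj₂ (above , proj₁ (proj₂ (proj₂ upper))))

    tallify : ∀ fuel {h} → IsSpanning h m → pred m * n < height h + fuel →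
      Σ (ℕ → Fin n) λ h′ → IsSpanning h′ m × IsTall h′ m × AgreeAtEnds h h′
    tallify fuel {h} sp bound with tall-or-obstructed h
    ... | inj₁ tall = h , sp , tall , λ _ _ → refl
    tallify zero {h} sp bound | inj₂ _ =
      contradiction (height-bounded h) (<⇒≱ (subst (pred m * n <_) (+-identityʳ _) bound))
    tallify (suc fuel) {h} sp bound | inj₂ obstruction with improve sp obstruction
    ... | h′ , sp′ , agree , higher
      with tallify fuel sp′ (≤-trans bound (≤-trans (≤-reflexive (+-suc (height h) fuel)) (+-monoˡ-≤ fuel higher)))
    ...   | h″ , sp″ , tall , agree′ = h″ , sp″ , tall , λ k k∈ → trans (agree′ k k∈) (agree k k∈)

    tall-version : ∀ {g} → IsSpanning g m → Σ (ℕ → Fin n) λ h → IsSpanning h m × IsTall h m × AgreeAtEnds g h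
    tall-version sp = tallify (suc (pred m * n)) sp (m≤n+m _ _)

lemma1p13 : (n : ℕ) (P : PermMatrix n) (m : ℕ) (X : Vec (Entry P) m) →
    IsMinSpanningOscillation P X →
    Σ (Vec (Entry P) m) λ Y → IsTallSpanningOscillation P Y
      × (∀ (p : 0 < m) → at P Y 0 p ≡ at P X 0 p)
      × (∀ (p : 1 < m) → at P Y 1 p ≡ at P X 1 p)
      × (∀ (p : m ∸ 2 < m) → at P Y (m ∸ 2) p ≡ at P X (m ∸ 2) p)
      × (∀ (p : m ∸ 1 < m) → at P Y (m ∸ 1) p ≡ at P X (m ∸ 1) p)
lemma1p13 n P m X (spanning , minimal) =
  table m h , (toDefs h h-spanning , isTall-toDefs h h-tall) ,
  keeps 0 (inj₁ (s≤s z≤n)) , keeps 1 (inj₁ ≤-refl) ,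
  keeps (m ∸ 2) (inj₂ ≤-refl) , keeps (m ∸ 1) (inj₂ (∸-monoʳ-≤ m (s≤s z≤n)))
  where
  open PermutationMatrix P
  open Oscillations _<r_ _<c_ using (IsMinimalLength)
  minimal′ : IsMinimalLength m
  minimal′ m′ f sp = minimal m′ (table m′ f) (toDefs f sp)
  open Tallification minimal′
  d = at P X 0 (<⇒≤ (Defs.IsSpanningOscillation.len≥2 spanning))
  result = tall-version (fromDefs X d spanning)
  h = proj₁ result
  h-spanning = proj₁ (proj₂ result)
  h-tall = proj₁ (proj₂ (proj₂ result))
  keeps : ∀ k → k < 2 ⊎ m ∸ 2 ≤ k → (p : k < m) → at P (table m h) k p ≡ at P X k p
  keeps k k∈ p = trans (at-table h k p) (trans (proj₂ (proj₂ (proj₂ result)) k k∈) (sym (at-get X d k p)))
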